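{- Let $\Phi\in\{B_n,C_n,D_n\}$, $\mathbf s\in{\rm Score}(\Phi)$, and suppose there is a path of length two between $\mathcal T_1,\mathcal T_2$ in ${\rm IntGr}(\Phi,\mathbf s)$ passing through $\mathcal T_{12}$, with copies of generators $\mathcal G_1,\mathcal G_2\subseteq\mathcal T_{12}$ such that $\mathcal T_i=\mathcal T_{12}*\mathcal G_i$ for $i=1,2$. Suppose $\mathcal G_1,\mathcal G_2$ are disjoint (share no game). If exactly zero, one, or two of $\mathcal G_1,\mathcal G_2$ are neutral clovers, then the network $N(\mathcal T_1,\mathcal T_2)$ is a single, double, or quadruple diamond, respectively.
   Context: Vectors: $\mathbf e^{\pm}_{ij}=\mathbf e_i\pm\mathbf e_j$ ($i>j$), $\mathbf e^h_i=\mathbf e_i$, $\mathbf e^\ell_i=2\mathbf e_i$ for negative edges $e^-_{ij}$, positive edges $e^+_{ij}$, half edges $e^h_i$, loops $e^\ell_i$. $\mathcal K_{D_n}$: all negative and positive edges on $[n]$; $\mathcal K_{B_n}$: these plus all half edges; $\mathcal K_{C_n}$: all negative and positive edges plus all loops. A Coxeter tournament on $\mathcal K_\Phi$ is $(w_e)$, $w_e\in\{0,1\}$, over its edges (games); score $\sum_e(w_e-\frac12)\mathbf e$; a sub-tournament (subset of games) is neutral if this sum over its games is $\mathbf 0$; $\mathcal T*\mathcal X$ flips the outcomes of the games of $\mathcal X$. ${\rm Score}(\Phi)$ = set of score sequences of tournaments on $\mathcal K_\Phi$. A copy of a type-$\Phi$ generator is a neutral sub-tournament whose games are: (a) neutral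 triangle (all types): three negative edges pairwise joining three distinct vertices, or one negative and two positive edges pairwise joining three distinct vertices; (b) neutral pair (only $B_n$): a negative or positive edge between $i\ne j$ plus $e^h_i,e^h_j$; (c) neutral clover (only $C_n$): $e^-_{ij},e^+_{ij},e^\ell_i$. ${\rm IntGr}(\Phi,\mathbf s)$: multigraph on tournaments on $\mathcal K_\Phi$ with score $\mathbf s$, with $\mathcal T_1,\mathcal T_2$ joined iff $\mathcal T_2=\mathcal T_1*\mathcal G$ for a generator copy $\mathcal G\subseteq\mathcal T_1$, by a double edge if $\mathcal G$ is a clover and a single edge otherwise. For $\mathcal T_1,\mathcal T_2$ at distance two, the interchange network $N(\mathcal T_1,\mathcal T_2)$ is the sub-multigraph formed by the union of all paths of length two between them (with both copies of double edges). It is a single diamond if it consists of two paths $\mathcal T_1-X-\mathcal T_2$, $\mathcal T_1-Y-\mathcal T_2$ with all four edges single; a double diamond if it consists of two such paths where $\mathcal T_1X$ and $Y\mathcal T_2$ are double edges and $\mathcal T_1Y$, $X\mathcal T_2$ single (each path has one double edge, the double edges not sharing an endpoint); a quadruple diamond if it consists of two such paths with all four edges double. -}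

module Defs where

open import Data.Nat using (ℕ)
open import Data.Bool using (Bool; true; false; not; if_then_else_)
open import Data.Fin using (Fin; _<_; _≟_)
open import Data.Fin.Properties using (<-trans)
open import Data.Integer using (ℤ; +_; -_; _+_; _-_; _*_)
open import Data.List using (List; []; _∷_; _++_; map; foldr; concatMap)
open import Data.List.Membership.Propositional using (_∈_)
open import Data.List.Base using (allFin)
open import Data.Product using (Σ; Σ-syntax; _×_; _,_)
open import Data.Sum using (_⊎_)
open import Data.Unit using (⊤)
open import Data.Empty using (⊥)
open import Relation.Nullary using (¬_; yes; no)
open import Relation.Nullary.Decidable using (⌊_⌋)
open import Relation.Binary.PropositionalEquality using (_≡_)

data Typ : Set where
  B C D : Typ

data Sign : Set where
  minus plus : Sign

-- Games (edges) of the complete graph K_Φ on vertex set [n] = Fin n.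
-- neg i j p  =  e^-_{ij}  (requires j < i)
-- pos i j p  =  e^+_{ij}  (requires j < i)
-- half i     =  e^h_i     (only in K_{B_n})
-- loop i     =  e^ℓ_i     (only in K_{C_n})

data Game (n : ℕ) : Typ → Set where
  neg  : ∀ {Φ} (i j : Fin n) → .(j < i) → Game n Φ
  pos  : ∀ {Φ} (i j : Fin n) → .(j < i) → Game n Φ
  half : Fin n → Game n B
  loop : Fin n → Game n C

edge : ∀ {n Φ} → Sign → (i j : Fin n) → .(j < i) → Game n Φ
edge minus i j p = neg i j p
edge plus  i j p = pos i j p

unit : ∀ {n} → Fin n → Fin n → ℤ
unit i k = if ⌊ i ≟ k ⌋ then + 1 else + 0

vec : ∀ {n Φ} → Game n Φ → Fin n → ℤ
vec (neg i j _) k = unit i k - unit j k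
vec (pos i j _) k = unit i k + unit j k
vec (half i)    k = unit i k
vec (loop i)    k = + 2 * unit i k

pairs : (n : ℕ) → List (Σ (Fin n) λ i → Σ (Fin n) λ j → j < i)
pairs n = concatMap (λ i → concatMap (λ j → f i j) (allFin n)) (allFin n)
  where
  f : (i j : Fin n) → List (Σ (Fin n) λ i → Σ (Fin n) λ j → j < i)
  f i j with Data.Fin._<?_ j i
  ... | yes p = (i , j , p) ∷ []
  ... | no _  = []

edgesD : ∀ {Φ} (n : ℕ) → List (Game n Φ)
edgesD n = concatMap (λ { (i , j , p) → neg i j p ∷ pos i j p ∷ [] }) (pairs n)

allGames : (Φ : Typ) (n : ℕ) → List (Game n Φ)
allGames B n = edgesD n ++ map half (allFin n)
allGames C n = edgesD n ++ map loop (allFin n)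
allGames D n = edgesD n

-- Tournaments: outcome w_e ∈ {0,1} (false = 0, true = 1) for every game.

Tournament : Typ → ℕ → Set
Tournament Φ n = Game n Φ → Bool

_≐_ : ∀ {Φ n} → Tournament Φ n → Tournament Φ n → Set
T ≐ T' = ∀ g → T g ≡ T' g

-- 2 (w_e - 1/2) ∈ {-1 , +1}
sgn : Bool → ℤ
sgn true  = + 1
sgn false = - (+ 1)

sumℤ : List ℤ → ℤ
sumℤ = foldr _+_ (+ 0)

-- TWICE the score  Σ_{e ∈ gs} (w_e - 1/2) e  (k-th coordinate); doubled to stay in ℤ
wsum : ∀ {Φ n} → Tournament Φ n → List (Game n Φ) → Fin n → ℤ
wsum T gs k = sumℤ (map (λ g → sgn (T g) * vec g k) gs)

-- the score sequence of T is s, where the argument s2 stands for 2·s ∈ ℤ^n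
HasScore : ∀ {Φ n} → Tournament Φ n → (Fin n → ℤ) → Set
HasScore {Φ} {n} T s2 = ∀ k → wsum T (allGames Φ n) k ≡ s2 k

InScore : (Φ : Typ) (n : ℕ) → (Fin n → ℤ) → Set
InScore Φ n s2 = Σ (Tournament Φ n) λ T → HasScore T s2

-- admissible signs for a triangle on vertices a > b > c with games on
-- the pairs (a,b), (a,c), (b,c): all negative, or one negative and two positive
data TriSigns : Sign → Sign → Sign → Set where
  nnn : TriSigns minus minus minus
  npp : TriSigns minus plus plus
  pnp : TriSigns plus minus plus
  ppn : TriSigns plus plus minus

data Gen (n : ℕ) : Typ → Set where
  triangle : ∀ {Φ} (a b c : Fin n) → .(b < a) → .(c < b) →
             (s₁ s₂ s₃ : Sign) → TriSigns s₁ s₂ s₃ → Gen n Φ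
  pair     : (s : Sign) (i j : Fin n) → .(j < i) → Gen n B
  clover   : (i j : Fin n) → .(j < i) → (l : Fin n) → (l ≡ i ⊎ l ≡ j) → Gen n C

games : ∀ {n Φ} → Gen n Φ → List (Game n Φ)
games (triangle a b c p q s₁ s₂ s₃ _) =
  edge s₁ a b p ∷ edge s₂ a c (<-trans q p) ∷ edge s₃ b c q ∷ []
games (pair s i j p) = edge s i j p ∷ half i ∷ half j ∷ []
games (clover i j p l _) = neg i j p ∷ pos i j p ∷ loop l ∷ []

IsClover : ∀ {n Φ} → Gen n Φ → Set
IsClover (clover _ _ _ _ _) = ⊤
IsClover (triangle _ _ _ _ _ _ _ _ _) = ⊥
IsClover (pair _ _ _ _) = ⊥

-- edge multiplicity contributed by flipping a generator copy
mult : ∀ {n Φ} → Gen n Φ → ℕ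
mult (clover _ _ _ _ _) = 2
mult (triangle _ _ _ _ _ _ _ _ _) = 1
mult (pair _ _ _ _) = 1

Neutral : ∀ {Φ n} → Tournament Φ n → Gen n Φ → Set
Neutral T G = ∀ k → wsum T (games G) k ≡ + 0

Flip : ∀ {Φ n} → Tournament Φ n → Gen n Φ → Tournament Φ n → Set
Flip T G T' = ∀ g → (g ∈ games G → T' g ≡ not (T g)) × (¬ (g ∈ games G) → T' g ≡ T g)

IsCopy : ∀ {Φ n} → Tournament Φ n → Gen n Φ → Set
IsCopy T G = Neutral T G

Disjoint : ∀ {Φ n} → Gen n Φ → Gen n Φ → Set
Disjoint G₁ G₂ = ∀ g → g ∈ games G₁ → ¬ (g ∈ games G₂)

-- Edge T — T' of multiplicity m:
-- T' = T * G for a generator copy G ⊆ T, m = 2 if G is a clover, else 1.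
-- (G is determined by T and T' as the set of games where they differ,
--  so m is the multiplicity of the (multi)edge.)

Edge : ∀ {Φ n} → (Fin n → ℤ) → Tournament Φ n → Tournament Φ n → ℕ → Set
Edge {Φ} {n} s2 T T' m =
  HasScore T s2 × HasScore T' s2 ×
  Σ (Gen n Φ) λ G → IsCopy T G × Flip T G T' × mult G ≡ m

Adjacent : ∀ {Φ n} → (Fin n → ℤ) → Tournament Φ n → Tournament Φ n → Set
Adjacent s2 T T' = Σ ℕ λ m → Edge s2 T T' m

DiamondShape : ∀ {Φ n} → (Fin n → ℤ) → Tournament Φ n → Tournament Φ n →
               ℕ → ℕ → ℕ → ℕ → Set
DiamondShape {Φ} {n} s2 T₁ T₂ a b c d =
  ¬ (T₁ ≐ T₂) × ¬ Adjacent s2 T₁ T₂ ×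
  Σ (Tournament Φ n) λ X → Σ (Tournament Φ n) λ Y →
    ¬ (X ≐ Y) ×
    Edge s2 T₁ X a × Edge s2 X T₂ b ×
    Edge s2 T₁ Y c × Edge s2 Y T₂ d ×
    (∀ Z → Adjacent s2 T₁ Z → Adjacent s2 Z T₂ → (Z ≐ X) ⊎ (Z ≐ Y))

SingleDiamond : ∀ {Φ n} → (Fin n → ℤ) → Tournament Φ n → Tournament Φ n → Set
SingleDiamond s2 T₁ T₂ = DiamondShape s2 T₁ T₂ 1 1 1 1

DoubleDiamond : ∀ {Φ n} → (Fin n → ℤ) → Tournament Φ n → Tournament Φ n → Set
DoubleDiamond s2 T₁ T₂ = DiamondShape s2 T₁ T₂ 2 1 1 2

QuadrupleDiamond : ∀ {Φ n} → (Fin n → ℤ) → Tournament Φ n → Tournament Φ n → Set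
QuadrupleDiamond s2 T₁ T₂ = DiamondShape s2 T₁ T₂ 2 2 2 2

{-# OPTIONS --safe #-}
-- Flips along disjoint sets of games commute, so Y = T₁₂ * G₁ * G₂ is a second common neighbour
-- of T₁ and T₂; at every game the outcomes of Y and T₁₂ are those of T₁ and T₂ in some order,
-- hence Y has score s as well. T₁ and T₂ differ on exactly the six games of G₁ ∪ G₂. A generator
-- has three games, so T₁ and T₂ are not adjacent, and if T₁ —H₁— Z —H₂— T₂ then H₁ ∪ H₂ must
-- cover these six games, hence every game of H₁ lies in G₁ or in G₂. Two games of H₁ lie in the
-- same Gᵢ, and since H₁ and Gᵢ are both neutral in T₁, their third games have the same signed
-- vector and therefore coincide. So H₁ = G₁ or H₁ = G₂, i.e. Z = T₁₂ or Z = Y, and the edge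
-- multiplicities of the diamond are those of G₁ (edges T₁T₁₂, YT₂) and of G₂ (edges T₁₂T₂, T₁Y).
module Submission where

open import Defs
open import Data.Bool using (Bool; true; false; not; _xor_)
open import Data.Bool.Properties using (not-involutive; not-¬)
open import Data.Empty using (⊥-elim)
open import Data.Fin as Fin using (Fin; _<_; _↑ˡ_; _↑ʳ_; splitAt; join; punchIn; punchOut)
open import Data.Fin.Patterns using (0F; 1F; 2F)
open import Data.Fin.Properties
  using ( <-cmp; <-trans; <⇒≢; any?; <⇒notInjective; injective⇒≤
        ; punchOut-injective; punchIn-punchOut; join-splitAt)
open import Data.Integer as ℤ using (ℤ; +_; +[1+_]; -[1+_]; -_; _+_; _*_)
import Data.Integer.Properties as ℤP
open import Data.List using (List; []; _∷_; tabulate)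
open import Data.List.Membership.Propositional using (_∈_; _∉_)
open import Data.List.Membership.Propositional.Properties using (∈-tabulate⁺; ∈-tabulate⁻)
open import Data.List.Relation.Binary.Subset.Propositional using (_⊆_)
open import Data.List.Relation.Unary.Any as Any using (here; there)
open import Data.Nat using (ℕ; zero; suc; _≤_; s≤s)
open import Data.Nat.Properties using (n<1+n)
open import Data.Product using (∃; _×_; _,_; proj₁; proj₂)
open import Data.Product.Properties using (≡-dec)
open import Data.Sum as Sum using (_⊎_; inj₁; inj₂; [_,_]′)
open import Data.Unit using (tt)
open import Data.Vec using (_∷_; []; lookup)
open import Data.Vec.Functional using (Vector; _++_; removeAt)
open import Data.Vec.Functional.Properties using (lookup-++ˡ; lookup-++ʳ)
open import Function using (_∘_; case_of_)
open import Function.Definitions using (Injective)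
open import Level using (0ℓ)
open import Relation.Binary using (Rel; Trichotomous; tri<; tri≈; tri>; DecidableEquality)
import Relation.Binary.Construct.Flip.EqAndOrd as Flipped
open import Relation.Binary.PropositionalEquality
open import Relation.Nullary using (¬_; Dec; yes; no; does; contradiction)
open import Relation.Nullary.Decidable using (map′; recompute; dec-true; dec-false)

open import Algebra.Properties.AbelianGroup ℤP.+-0-abelianGroup using (∙-cancelˡ; ∙-cancelʳ)
open import Algebra.Properties.CommutativeMonoid.Sum ℤP.+-0-commutativeMonoid
  using (sum; sum-remove)
open import Algebra.Properties.CommutativeSemigroup ℤP.+-commutativeSemigroup using (interchange)

injective⇒surjective : ∀ {m} {f : Fin m → Fin m} → Injective _≡_ _≡_ f → ∀ y → ∃ λ x → f x ≡ y
injective⇒surjective {zero}  _ ()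
injective⇒surjective {suc m} {f} f-injective y with any? (λ x → f x Fin.≟ y)
... | yes hit  = hit
... | no  miss = ⊥-elim (<⇒notInjective (n<1+n m) punchOut∘f-injective)
  where
  y≢f : ∀ x → y ≢ f x
  y≢f x y≡fx = miss (x , sym y≡fx)
  punchOut∘f-injective : Injective _≡_ _≡_ (λ x → punchOut (y≢f x))
  punchOut∘f-injective eq = f-injective (punchOut-injective (y≢f _) (y≢f _) eq)

module _ {A : Set} {m l : ℕ} {U : Fin m → A} {W : Fin l → A} where

  cover-injective : Injective _≡_ _≡_ U → (cover : ∀ k → ∃ λ s → U k ≡ W s) →
                    Injective _≡_ _≡_ (proj₁ ∘ cover)
  cover-injective U-injective cover {k} {k′} eq =
    U-injective (trans (proj₂ (cover k)) (trans (cong W eq) (sym (proj₂ (cover k′)))))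

  injective-cover⇒≤ : Injective _≡_ _≡_ U → (∀ k → ∃ λ s → U k ≡ W s) → m ≤ l
  injective-cover⇒≤ U-injective cover = injective⇒≤ (cover-injective U-injective cover)

injective-cover⇒onto : ∀ {A : Set} {m} {U W : Fin m → A} → Injective _≡_ _≡_ U →
                       (∀ k → ∃ λ s → U k ≡ W s) → ∀ s → ∃ λ k → U k ≡ W s
injective-cover⇒onto {W = W} U-injective cover s
  with k , slot≡s ← injective⇒surjective (cover-injective U-injective cover) s =
  k , trans (proj₂ (cover k)) (cong W slot≡s)

module _ {A : Set} {m n : ℕ} {xs : Vector A m} {ys : Vector A n} where

  ++-injective : Injective _≡_ _≡_ xs → Injective _≡_ _≡_ ys → (∀ i j → xs i ≢ ys j) →
                 Injective _≡_ _≡_ (xs ++ ys)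
  ++-injective xs-injective ys-injective xs≢ys {i} {j} eq = begin
    i                       ≡⟨ join-splitAt m n i ⟨
    join m n (splitAt m i)  ≡⟨ cong (join m n) (halves-injective (splitAt m i) (splitAt m j) eq) ⟩
    join m n (splitAt m j)  ≡⟨ join-splitAt m n j ⟩
    j                       ∎
    where
    open ≡-Reasoning
    halves-injective : ∀ a b → [ xs , ys ]′ a ≡ [ xs , ys ]′ b → a ≡ b
    halves-injective (inj₁ a) (inj₁ b) eq = cong inj₁ (xs-injective eq)
    halves-injective (inj₂ a) (inj₂ b) eq = cong inj₂ (ys-injective eq)
    halves-injective (inj₁ a) (inj₂ b) eq = ⊥-elim (xs≢ys a b eq)
    halves-injective (inj₂ a) (inj₁ b) eq = ⊥-elim (xs≢ys b a (sym eq))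

  ++-halves : ∀ k → (∃ λ i → (xs ++ ys) k ≡ xs i) ⊎ (∃ λ j → (xs ++ ys) k ≡ ys j)
  ++-halves k with splitAt m k
  ... | inj₁ i = inj₁ (i , refl)
  ... | inj₂ j = inj₂ (j , refl)

distinct₃-injective : ∀ {A : Set} {x y z : A} → x ≢ y → x ≢ z → y ≢ z →
                      Injective _≡_ _≡_ (lookup (x ∷ y ∷ z ∷ []))
distinct₃-injective _   _   _   {0F} {0F} _  = refl
distinct₃-injective _   _   _   {1F} {1F} _  = refl
distinct₃-injective _   _   _   {2F} {2F} _  = refl
distinct₃-injective x≢y _   _   {0F} {1F} eq = contradiction eq x≢y
distinct₃-injective x≢y _   _   {1F} {0F} eq = contradiction (sym eq) x≢y
distinct₃-injective _   x≢z _   {0F} {2F} eq = contradiction eq x≢z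
distinct₃-injective _   x≢z _   {2F} {0F} eq = contradiction (sym eq) x≢z
distinct₃-injective _   _   y≢z {1F} {2F} eq = contradiction eq y≢z
distinct₃-injective _   _   y≢z {2F} {1F} eq = contradiction (sym eq) y≢z

module _ {A : Set} {_≺_ : Rel A 0ℓ} (compare : Trichotomous _≡_ _≺_) (P : A → Set) where

  least-unique : ∀ {i j} → P i → P j → (∀ {k} → k ≺ i → ¬ P k) → (∀ {k} → k ≺ j → ¬ P k) → i ≡ j
  least-unique {i} {j} Pi Pj i-least j-least with compare i j
  ... | tri< i≺j _ _ = contradiction Pi (j-least i≺j)
  ... | tri≈ _ i≡j _ = i≡j
  ... | tri> _ _ j≺i = contradiction Pj (i-least j≺i)

-- the element of Fin 3 other than p and q
third : (p q : Fin 3) → p ≢ q → Fin 3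
third p q p≢q = punchIn p (punchIn (punchOut p≢q) 0F)

sum-third : (c : Fin 3 → ℤ) {p q : Fin 3} (p≢q : p ≢ q) → sum c ≡ c p + (c q + c (third p q p≢q))
sum-third c {p} {q} p≢q = begin
  sum c
    ≡⟨ sum-remove c ⟩
  c p + sum (removeAt c p)
    ≡⟨ cong (λ t → c p + t) (sum-remove (removeAt c p)) ⟩
  c p + (c (punchIn p (punchOut p≢q)) + (c r + + 0))
    ≡⟨ cong₂ (λ s t → c p + (c s + t)) (punchIn-punchOut p≢q) (ℤP.+-identityʳ (c r)) ⟩
  c p + (c q + c r)
    ∎
  where
  open ≡-Reasoning
  r = third p q p≢q

ThirdClosed : (Fin 3 → Set) → Set
ThirdClosed P = ∀ p q (p≢q : p ≢ q) → P p → P q → P (third p q p≢q)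

all-on-one-side : {P Q : Fin 3 → Set} → (∀ p → P p ⊎ Q p) → (∀ {p} → P p → ¬ Q p) →
                  ThirdClosed P → ThirdClosed Q → (∀ p → P p) ⊎ (∀ p → Q p)
all-on-one-side side P∩Q=∅ P-closed Q-closed with side 0F | side 1F | side 2F
... | inj₁ a | inj₁ b | inj₁ c = inj₁ λ { 0F → a ; 1F → b ; 2F → c }
... | inj₂ a | inj₂ b | inj₂ c = inj₂ λ { 0F → a ; 1F → b ; 2F → c }
... | inj₁ a | inj₁ b | inj₂ c = ⊥-elim (P∩Q=∅ (P-closed 0F 1F (λ ()) a b) c)
... | inj₁ a | inj₂ b | inj₁ c = ⊥-elim (P∩Q=∅ (P-closed 0F 2F (λ ()) a c) b)
... | inj₂ a | inj₁ b | inj₁ c = ⊥-elim (P∩Q=∅ (P-closed 1F 2F (λ ()) b c) a)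
... | inj₂ a | inj₂ b | inj₁ c = ⊥-elim (P∩Q=∅ c (Q-closed 0F 1F (λ ()) a b))
... | inj₂ a | inj₁ b | inj₂ c = ⊥-elim (P∩Q=∅ b (Q-closed 0F 2F (λ ()) a c))
... | inj₁ a | inj₂ b | inj₂ c = ⊥-elim (P∩Q=∅ a (Q-closed 1F 2F (λ ()) b c))

recompute-< : ∀ {n} {i j : Fin n} → .(i < j) → i < j
recompute-< {i = i} {j} i<j = recompute (i Fin.<? j) i<j

irrelevant-<⇒≢ : ∀ {n} {i j : Fin n} → .(i < j) → i ≢ j
irrelevant-<⇒≢ i<j = <⇒≢ (recompute-< i<j)

unit-diag : ∀ {n} (i : Fin n) → unit i i ≡ + 1
unit-diag i with i Fin.≟ i
... | yes _   = refl
... | no  i≢i = contradiction refl i≢i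

unit-off : ∀ {n} {i k : Fin n} → i ≢ k → unit i k ≡ + 0
unit-off {i = i} {k} i≢k with i Fin.≟ k
... | yes i≡k = contradiction i≡k i≢k
... | no  _   = refl

unit-< : ∀ {n} {i k : Fin n} → i < k → unit i k ≡ + 0
unit-< = unit-off ∘ <⇒≢

unit-> : ∀ {n} {i k : Fin n} → k < i → unit i k ≡ + 0
unit-> k<i = unit-off (≢-sym (<⇒≢ k<i))

sgn-*-≡0 : ∀ b {v} → sgn b * v ≡ + 0 → v ≡ + 0
sgn-*-≡0 true  {v} eq = trans (sym (ℤP.*-identityˡ v)) eq
sgn-*-≡0 false {v} eq = ℤP.neg-injective (trans (sym (ℤP.-1*i≡-i v)) eq)

sgn-*-cancelˡ : ∀ b {u v} → sgn b * u ≡ sgn b * v → u ≡ v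
sgn-*-cancelˡ true  {u} {v} eq = trans (sym (ℤP.*-identityˡ u)) (trans eq (ℤP.*-identityˡ v))
sgn-*-cancelˡ false {u} {v} eq =
  ℤP.neg-injective (trans (sym (ℤP.-1*i≡-i u)) (trans eq (ℤP.-1*i≡-i v)))

sgn-injective : ∀ {x y} c d → sgn x * +[1+ c ] ≡ sgn y * +[1+ d ] → x ≡ y
sgn-injective {true}  {true}  _ _ _  = refl
sgn-injective {false} {false} _ _ _  = refl
sgn-injective {true}  {false} _ _ ()
sgn-injective {false} {true}  _ _ ()

sgn-not : ∀ b → sgn (not b) ≡ - sgn b
sgn-not true  = refl
sgn-not false = refl

module _ {n : ℕ} {Φ : Typ} where

  top bot : Game n Φ → Fin n
  top (neg i _ _) = i
  top (pos i _ _) = i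
  top (half i)    = i
  top (loop i)    = i
  bot (neg _ j _) = j
  bot (pos _ j _) = j
  bot (half i)    = i
  bot (loop i)    = i

  bot-coefficient : Game n Φ → ℤ
  bot-coefficient (neg _ _ _) = -[1+ 0 ]
  bot-coefficient (pos _ _ _) = + 1
  bot-coefficient (half _)    = + 1
  bot-coefficient (loop _)    = + 2

  -- top and bot are the largest and smallest coordinates in the support of vec g,
  -- so the key of a game can be read off its vector.
  key : Game n Φ → Fin n × Fin n × ℤ
  key g = top g , bot g , bot-coefficient g

  key-injective : Injective _≡_ _≡_ key
  key-injective {neg _ _ _}   {neg _ _ _}   refl = refl
  key-injective {pos _ _ _}   {pos _ _ _}   refl = refl
  key-injective {half _}      {half _}      refl = refl
  key-injective {loop _}      {loop _}      refl = refl
  key-injective {pos _ _ j<i} {half _}      refl = contradiction refl (irrelevant-<⇒≢ j<i)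
  key-injective {half _}      {pos _ _ j<i} refl = contradiction refl (irrelevant-<⇒≢ j<i)
  key-injective {neg _ _ _}   {pos _ _ _}   ()
  key-injective {neg _ _ _}   {half _}      ()
  key-injective {neg _ _ _}   {loop _}      ()
  key-injective {pos _ _ _}   {neg _ _ _}   ()
  key-injective {pos _ _ _}   {loop _}      ()
  key-injective {half _}      {neg _ _ _}   ()
  key-injective {loop _}      {neg _ _ _}   ()
  key-injective {loop _}      {pos _ _ _}   ()

  _≟ᵍ_ : DecidableEquality (Game n Φ)
  a ≟ᵍ b = map′ key-injective (cong key) (≡-dec Fin._≟_ (≡-dec Fin._≟_ ℤ._≟_) (key a) (key b))

  _∈?_ : (g : Game n Φ) (gs : List (Game n Φ)) → Dec (g ∈ gs)
  g ∈? gs = Any.any? (g ≟ᵍ_) gs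

  _∈ᵇ_ : Game n Φ → Gen n Φ → Bool
  g ∈ᵇ G = does (g ∈? games G)

  vec-top : ∀ g → ∃ λ c → vec g (top g) ≡ +[1+ c ]
  vec-top (neg i j j<i) rewrite unit-diag i | unit-off (irrelevant-<⇒≢ j<i) = 0 , refl
  vec-top (pos i j j<i) rewrite unit-diag i | unit-off (irrelevant-<⇒≢ j<i) = 0 , refl
  vec-top (half i)      rewrite unit-diag i = 0 , refl
  vec-top (loop i)      rewrite unit-diag i = 1 , refl

  vec-above : ∀ g {k} → top g < k → vec g k ≡ + 0
  vec-above (neg i j j<i) i<k rewrite unit-< i<k | unit-< (<-trans (recompute-< j<i) i<k) = refl
  vec-above (pos i j j<i) i<k rewrite unit-< i<k | unit-< (<-trans (recompute-< j<i) i<k) = refl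
  vec-above (half i)      i<k rewrite unit-< i<k = refl
  vec-above (loop i)      i<k rewrite unit-< i<k = refl

  vec-bot : ∀ g → vec g (bot g) ≡ bot-coefficient g
  vec-bot (neg i j j<i) rewrite unit-> (recompute-< j<i) | unit-diag j = refl
  vec-bot (pos i j j<i) rewrite unit-> (recompute-< j<i) | unit-diag j = refl
  vec-bot (half i)      = unit-diag i
  vec-bot (loop i)      rewrite unit-diag i = refl

  vec-below : ∀ g {k} → k < bot g → vec g k ≡ + 0
  vec-below (neg i j j<i) k<j rewrite unit-> (<-trans k<j (recompute-< j<i)) | unit-> k<j = refl
  vec-below (pos i j j<i) k<j rewrite unit-> (<-trans k<j (recompute-< j<i)) | unit-> k<j = refl
  vec-below (half i)      k<i rewrite unit-> k<i = refl
  vec-below (loop i)      k<i rewrite unit-> k<i = refl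

  vec-top≢0 : ∀ g → vec g (top g) ≢ + 0
  vec-top≢0 g with c , top-value ← vec-top g = λ eq → case trans (sym top-value) eq of λ ()

  vec-bot≢0 : ∀ g → vec g (bot g) ≢ + 0
  vec-bot≢0 g eq = bot-coefficient≢0 g (trans (sym (vec-bot g)) eq)
    where
    bot-coefficient≢0 : ∀ g → bot-coefficient g ≢ + 0
    bot-coefficient≢0 (neg _ _ _) ()
    bot-coefficient≢0 (pos _ _ _) ()
    bot-coefficient≢0 (half _)    ()
    bot-coefficient≢0 (loop _)    ()

  same-support⇒same-ends : ∀ {a b} → (∀ k → vec a k ≡ + 0 → vec b k ≡ + 0) →
                           (∀ k → vec b k ≡ + 0 → vec a k ≡ + 0) → top a ≡ top b × bot a ≡ bot b
  same-support⇒same-ends {a} {b} a→b b→a =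
    least-unique (Flipped.compare _<_ <-cmp) support
      (vec-top≢0 a) (vec-top≢0 b ∘ a→b _)
      (λ top<k s → s (vec-above a top<k)) (λ top<k s → s (b→a _ (vec-above b top<k))) ,
    least-unique <-cmp support
      (vec-bot≢0 a) (vec-bot≢0 b ∘ a→b _)
      (λ k<bot s → s (vec-below a k<bot)) (λ k<bot s → s (b→a _ (vec-below b k<bot)))
    where
    support : Fin n → Set
    support k = vec a k ≢ + 0

  signed-vec-injective : ∀ {a b} x y → (∀ k → sgn x * vec a k ≡ sgn y * vec b k) → a ≡ b
  signed-vec-injective {a} {b} x y eq = key-injective (cong₂ _,_ top≡ (cong₂ _,_ bot≡ coefficient≡))
    where
    open ≡-Reasoning
    ends : top a ≡ top b × bot a ≡ bot b
    ends = same-support⇒same-ends {a} {b}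
      (λ k z → sgn-*-≡0 y (trans (sym (eq k)) (trans (cong (sgn x *_) z) (ℤP.*-zeroʳ (sgn x)))))
      (λ k z → sgn-*-≡0 x (trans (eq k) (trans (cong (sgn y *_) z) (ℤP.*-zeroʳ (sgn y)))))
    top≡ = proj₁ ends
    bot≡ = proj₂ ends
    x≡y : x ≡ y
    x≡y with c , a-top ← vec-top a | d , b-top ← vec-top b = sgn-injective c d (begin
      sgn x * +[1+ c ]       ≡⟨ cong (sgn x *_) a-top ⟨
      sgn x * vec a (top a)  ≡⟨ eq (top a) ⟩
      sgn y * vec b (top a)  ≡⟨ cong (λ k → sgn y * vec b k) top≡ ⟩
      sgn y * vec b (top b)  ≡⟨ cong (sgn y *_) b-top ⟩
      sgn y * +[1+ d ]       ∎)
    same-vec : ∀ k → vec a k ≡ vec b k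
    same-vec k = sgn-*-cancelˡ x (trans (eq k) (cong (λ z → sgn z * vec b k) (sym x≡y)))
    coefficient≡ : bot-coefficient a ≡ bot-coefficient b
    coefficient≡ = begin
      bot-coefficient a  ≡⟨ vec-bot a ⟨
      vec a (bot a)      ≡⟨ same-vec (bot a) ⟩
      vec b (bot a)      ≡⟨ cong (vec b) bot≡ ⟩
      vec b (bot b)      ≡⟨ vec-bot b ⟩
      bot-coefficient b  ∎

edge-injective : ∀ {n Φ} s s′ {i j i′ j′ : Fin n} .{j<i : j < i} .{j′<i′ : j′ < i′} →
                 edge {Φ = Φ} s i j j<i ≡ edge s′ i′ j′ j′<i′ → i ≡ i′ × j ≡ j′
edge-injective minus minus refl = refl , refl
edge-injective plus  plus  refl = refl , refl
edge-injective minus plus  ()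
edge-injective plus  minus ()

edge≢half : ∀ {n} s {i j k : Fin n} .{j<i : j < i} → edge s i j j<i ≢ half k
edge≢half minus ()
edge≢half plus  ()

module _ {n : ℕ} {Φ : Typ} where

  game : Gen n Φ → Vector (Game n Φ) 3
  game (triangle a b c b<a c<b s₁ s₂ s₃ _) =
    lookup (edge s₁ a b b<a ∷ edge s₂ a c (<-trans c<b b<a) ∷ edge s₃ b c c<b ∷ [])
  game (pair s i j j<i)     = lookup (edge s i j j<i ∷ half i ∷ half j ∷ [])
  game (clover i j j<i l _) = lookup (neg i j j<i ∷ pos i j j<i ∷ loop l ∷ [])

  games-tabulate : ∀ G → games G ≡ tabulate (game G)
  games-tabulate (triangle _ _ _ _ _ _ _ _ _) = refl
  games-tabulate (pair _ _ _ _)               = refl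
  games-tabulate (clover _ _ _ _ _)           = refl

  ∈-games⁻ : ∀ {G g} → g ∈ games G → ∃ λ p → g ≡ game G p
  ∈-games⁻ {G} {g} g∈G = ∈-tabulate⁻ (subst (g ∈_) (games-tabulate G) g∈G)

  ∈-games⁺ : ∀ G p → game G p ∈ games G
  ∈-games⁺ G p = subst (game G p ∈_) (sym (games-tabulate G)) (∈-tabulate⁺ {f = game G} p)

  game-injective : ∀ G → Injective _≡_ _≡_ (game G)
  game-injective (triangle a b c b<a c<b s₁ s₂ s₃ _) = distinct₃-injective
    (λ eq → irrelevant-<⇒≢ c<b (sym (proj₂ (edge-injective s₁ s₂ eq))))
    (λ eq → irrelevant-<⇒≢ b<a (sym (proj₁ (edge-injective s₁ s₃ eq))))
    (λ eq → irrelevant-<⇒≢ b<a (sym (proj₁ (edge-injective s₂ s₃ eq))))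
  game-injective (pair s i j j<i) = distinct₃-injective
    (edge≢half s) (edge≢half s) (λ eq → irrelevant-<⇒≢ j<i (sym (cong top eq)))
  game-injective (clover _ _ _ _ _) = distinct₃-injective (λ ()) (λ ()) (λ ())

  games⊆⇒⊇ : ∀ {G H} → games G ⊆ games H → games H ⊆ games G
  games⊆⇒⊇ {G} {H} G⊆H g∈H
    with p , g≡Hp ← ∈-games⁻ g∈H
    with k , Gk≡Hp ← injective-cover⇒onto (game-injective G) (∈-games⁻ ∘ G⊆H ∘ ∈-games⁺ G) p
    = subst (_∈ games G) (trans Gk≡Hp (sym g≡Hp)) (∈-games⁺ G k)

  game-++-∈ : ∀ {G H : Gen n Φ} k →
              (game G ++ game H) k ∈ games G ⊎ (game G ++ game H) k ∈ games H
  game-++-∈ {G} {H} k with ++-halves {xs = game G} {ys = game H} k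
  ... | inj₁ (i , eq) = inj₁ (subst (_∈ games G) (sym eq) (∈-games⁺ G i))
  ... | inj₂ (j , eq) = inj₂ (subst (_∈ games H) (sym eq) (∈-games⁺ H j))

  ∈⇒game-++ : ∀ {G H : Gen n Φ} {g} → g ∈ games G ⊎ g ∈ games H → ∃ λ s → g ≡ (game G ++ game H) s
  ∈⇒game-++ {G} {H} (inj₁ g∈G) with p , g≡Gp ← ∈-games⁻ g∈G =
    p ↑ˡ 3 , trans g≡Gp (sym (lookup-++ˡ (game G) (game H) p))
  ∈⇒game-++ {G} {H} (inj₂ g∈H) with q , g≡Hq ← ∈-games⁻ g∈H =
    3 ↑ʳ q , trans g≡Hq (sym (lookup-++ʳ (game G) (game H) q))

xor-cancelˡ : ∀ a b → a xor (a xor b) ≡ b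
xor-cancelˡ true  b = not-involutive b
xor-cancelˡ false b = refl

xor-swap : ∀ a b c → a xor (b xor c) ≡ b xor (a xor c)
xor-swap true  true  c = refl
xor-swap true  false c = refl
xor-swap false b     c = refl

≡not⇒≢ : ∀ {x y} → x ≡ not y → x ≢ y
≡not⇒≢ x≡not-y x≡y = not-¬ refl (trans (sym x≡y) x≡not-y)

module _ {n : ℕ} {Φ : Typ} {G : Gen n Φ} where

  Flip⇒xor : ∀ {T X} → Flip T G X → ∀ g → X g ≡ (g ∈ᵇ G) xor T g
  Flip⇒xor T→X g with g ∈? games G
  ... | yes g∈G = proj₁ (T→X g) g∈G
  ... | no  g∉G = proj₂ (T→X g) g∉G

  xor⇒Flip : ∀ {T X} → (∀ g → X g ≡ (g ∈ᵇ G) xor T g) → Flip T G X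
  xor⇒Flip {T} X≡ g =
    (λ g∈G → trans (X≡ g) (cong (_xor T g) (dec-true (g ∈? games G) g∈G))) ,
    (λ g∉G → trans (X≡ g) (cong (_xor T g) (dec-false (g ∈? games G) g∉G)))

  Flip-sym : ∀ {T X} → Flip T G X → Flip X G T
  Flip-sym {T} T→X = xor⇒Flip λ g →
    trans (sym (xor-cancelˡ (g ∈ᵇ G) (T g))) (cong ((g ∈ᵇ G) xor_) (sym (Flip⇒xor T→X g)))

  Flip-≢⇒∈ : ∀ {T X} → Flip T G X → ∀ {g} → X g ≢ T g → g ∈ games G
  Flip-≢⇒∈ T→X {g} X≢T with g ∈? games G
  ... | yes g∈G = g∈G
  ... | no  g∉G = contradiction (proj₂ (T→X g) g∉G) X≢T

_⊛_ : ∀ {n Φ} → Tournament Φ n → Gen n Φ → Tournament Φ n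
(T ⊛ G) g = (g ∈ᵇ G) xor T g

Flip-⊛ : ∀ {n Φ} {T : Tournament Φ n} {G} → Flip T G (T ⊛ G)
Flip-⊛ = xor⇒Flip λ _ → refl

Flip-unique : ∀ {n Φ} {T X Z : Tournament Φ n} {G H} →
              Flip T G X → Flip T H Z → games G ⊆ games H → games H ⊆ games G → X ≐ Z
Flip-unique {G = G} T→X T→Z G⊆H H⊆G g with g ∈? games G
... | yes g∈G = trans (proj₁ (T→X g) g∈G) (sym (proj₁ (T→Z g) (G⊆H g∈G)))
... | no  g∉G = trans (proj₂ (T→X g) g∉G) (sym (proj₂ (T→Z g) (g∉G ∘ H⊆G)))

module _ {n : ℕ} {Φ : Typ} {T X W : Tournament Φ n} {G H : Gen n Φ} where

  Flip²-≢⇒∈ : Flip T G X → Flip X H W → ∀ {g} → W g ≢ T g → g ∈ games G ⊎ g ∈ games H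
  Flip²-≢⇒∈ T→X X→W {g} W≢T with g ∈? games H
  ... | yes g∈H = inj₂ g∈H
  ... | no  g∉H = inj₁ (Flip-≢⇒∈ T→X λ X≡T → W≢T (trans (proj₂ (X→W g) g∉H) X≡T))

  Flip²-once⇒≢ : Flip T G X → Flip X H W → ∀ {g} →
                 (g ∈ games G × g ∉ games H) ⊎ (g ∉ games G × g ∈ games H) → W g ≢ T g
  Flip²-once⇒≢ T→X X→W {g} (inj₁ (g∈G , g∉H)) =
    ≡not⇒≢ (trans (proj₂ (X→W g) g∉H) (proj₁ (T→X g) g∈G))
  Flip²-once⇒≢ T→X X→W {g} (inj₂ (g∉G , g∈H)) =
    ≡not⇒≢ (trans (proj₁ (X→W g) g∈H) (cong not (proj₂ (T→X g) g∉G)))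

Parallelogram : ∀ {n Φ} (T X Z W : Tournament Φ n) → Set
Parallelogram T X Z W = ∀ g → (W g ≡ X g × T g ≡ Z g) ⊎ (W g ≡ Z g × T g ≡ X g)

module _ {n : ℕ} {Φ : Typ} {T X Z W : Tournament Φ n} {G H : Gen n Φ} where

  Flip-square : Flip T G X → Flip T H Z → Flip X H W → Flip Z G W
  Flip-square T→X T→Z X→W = xor⇒Flip λ g → begin
    W g                               ≡⟨ Flip⇒xor X→W g ⟩
    (g ∈ᵇ H) xor X g                  ≡⟨ cong ((g ∈ᵇ H) xor_) (Flip⇒xor T→X g) ⟩
    (g ∈ᵇ H) xor ((g ∈ᵇ G) xor T g)   ≡⟨ xor-swap (g ∈ᵇ H) (g ∈ᵇ G) (T g) ⟩
    (g ∈ᵇ G) xor ((g ∈ᵇ H) xor T g)   ≡⟨ cong ((g ∈ᵇ G) xor_) (Flip⇒xor T→Z g) ⟨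
    (g ∈ᵇ G) xor Z g                  ∎
    where open ≡-Reasoning

  Flip-parallelogram : Flip T G X → Flip T H Z → Flip X H W → Disjoint G H → Parallelogram T X Z W
  Flip-parallelogram T→X T→Z X→W G∩H=∅ g with g ∈? games H
  ... | no  g∉H = inj₁ (proj₂ (X→W g) g∉H , sym (proj₂ (T→Z g) g∉H))
  ... | yes g∈H = inj₂ (trans (proj₁ (X→W g) g∈H) (trans (cong not X≡T) (sym (proj₁ (T→Z g) g∈H))) ,
                        sym X≡T)
    where
    X≡T : X g ≡ T g
    X≡T = proj₂ (T→X g) (λ g∈G → G∩H=∅ g g∈G g∈H)

module _ {n : ℕ} {Φ : Typ} where

  contribution : Tournament Φ n → Game n Φ → Fin n → ℤ
  contribution T g k = sgn (T g) * vec g k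

  wsum-games : ∀ T G k → wsum T (games G) k ≡ sum (λ p → contribution T (game G p) k)
  wsum-games T (triangle _ _ _ _ _ _ _ _ _) k = refl
  wsum-games T (pair _ _ _ _)               k = refl
  wsum-games T (clover _ _ _ _ _)           k = refl

  wsum-cong : ∀ {T X : Tournament Φ n} {gs} → (∀ {g} → g ∈ gs → X g ≡ T g) →
              ∀ k → wsum X gs k ≡ wsum T gs k
  wsum-cong {gs = []}     _     k = refl
  wsum-cong {gs = g ∷ gs} agree k =
    cong₂ (λ b r → sgn b * vec g k + r) (agree (here refl)) (wsum-cong (agree ∘ there) k)

  wsum-not : ∀ {T X : Tournament Φ n} {gs} → (∀ {g} → g ∈ gs → X g ≡ not (T g)) →
             ∀ k → wsum X gs k ≡ - wsum T gs k
  wsum-not {gs = []}        _       k = refl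
  wsum-not {T} {X} {g ∷ gs} flipped k = begin
    c (X g) + wsum X gs k
      ≡⟨ cong₂ (λ b r → c b + r) (flipped (here refl)) (wsum-not (flipped ∘ there) k) ⟩
    c (not (T g)) + - wsum T gs k  ≡⟨ cong (_+ - wsum T gs k) (c-not (T g)) ⟩
    - c (T g) + - wsum T gs k      ≡⟨ ℤP.neg-distrib-+ (c (T g)) (wsum T gs k) ⟨
    - (c (T g) + wsum T gs k)      ∎
    where
    open ≡-Reasoning
    c : Bool → ℤ
    c b = sgn b * vec g k
    c-not : ∀ b → c (not b) ≡ - c b
    c-not b = trans (cong (_* vec g k) (sgn-not b)) (sym (ℤP.neg-distribˡ-* (sgn b) (vec g k)))

  Neutral-Flip : ∀ {T X G} → Neutral T G → Flip T G X → Neutral X G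
  Neutral-Flip {T} {X} {G} G-neutral T→X k = begin
    wsum X (games G) k    ≡⟨ wsum-not (λ {g} → proj₁ (T→X g)) k ⟩
    - wsum T (games G) k  ≡⟨ cong -_ (G-neutral k) ⟩
    + 0                   ∎
    where open ≡-Reasoning

  Neutral-Flip-disjoint : ∀ {T X G H} → Neutral T H → Flip T G X → Disjoint H G → Neutral X H
  Neutral-Flip-disjoint H-neutral T→X H∩G=∅ k =
    trans (wsum-cong (λ {g} g∈H → proj₂ (T→X g) (H∩G=∅ g g∈H)) k) (H-neutral k)

  shared-pair⇒shared-third : ∀ {T G H} → Neutral T G → Neutral T H →
                             ∀ {p q x y} (p≢q : p ≢ q) → game H p ≡ game G x → game H q ≡ game G y →
                             ∃ λ z → game H (third p q p≢q) ≡ game G z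
  shared-pair⇒shared-third {T} {G} {H} G-neutral H-neutral {p} {q} {x} {y} p≢q Hp≡Gx Hq≡Gy =
    z , signed-vec-injective (T (game H r)) (T (game G z)) third-contributions
    where
    open ≡-Reasoning
    x≢y : x ≢ y
    x≢y x≡y = p≢q (game-injective H (trans Hp≡Gx (trans (cong (game G) x≡y) (sym Hq≡Gy))))
    r = third p q p≢q
    z = third x y x≢y
    cH cG : Fin n → Fin 3 → ℤ
    cH k s = contribution T (game H s) k
    cG k s = contribution T (game G s) k
    third-contributions : ∀ k → cH k r ≡ cG k z
    third-contributions k = ∙-cancelˡ (cH k q) _ _ (∙-cancelˡ (cH k p) _ _ (begin
      cH k p + (cH k q + cH k r)  ≡⟨ sum-third (cH k) p≢q ⟨
      sum (cH k)                  ≡⟨ wsum-games T H k ⟨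
      wsum T (games H) k          ≡⟨ H-neutral k ⟩
      + 0                         ≡⟨ G-neutral k ⟨
      wsum T (games G) k          ≡⟨ wsum-games T G k ⟩
      sum (cG k)                  ≡⟨ sum-third (cG k) x≢y ⟩
      cG k x + (cG k y + cG k z)
        ≡⟨ cong₂ (λ g g′ → contribution T g k + (contribution T g′ k + cG k z)) Hp≡Gx Hq≡Gy ⟨
      cH k p + (cH k q + cG k z)  ∎))

  neutral-third-closed : ∀ {T G H} → Neutral T G → Neutral T H →
                         ThirdClosed (λ p → game H p ∈ games G)
  neutral-third-closed {T} {G} {H} G-neutral H-neutral p q p≢q Hp∈G Hq∈G
    with x , Hp≡Gx ← ∈-games⁻ Hp∈G
    with y , Hq≡Gy ← ∈-games⁻ Hq∈G
    with z , Hr≡Gz ← shared-pair⇒shared-third {T} {G} {H} G-neutral H-neutral p≢q Hp≡Gx Hq≡Gy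
    = subst (_∈ games G) (sym Hr≡Gz) (∈-games⁺ G z)

  wsum-parallelogram : ∀ {T X Z W : Tournament Φ n} → Parallelogram T X Z W →
                       ∀ gs k → wsum W gs k + wsum T gs k ≡ wsum X gs k + wsum Z gs k
  wsum-parallelogram _ [] k = refl
  wsum-parallelogram {T} {X} {Z} {W} parallel (g ∷ gs) k = begin
    (c (W g) + wsum W gs k) + (c (T g) + wsum T gs k)
      ≡⟨ interchange (c (W g)) (wsum W gs k) (c (T g)) (wsum T gs k) ⟩
    (c (W g) + c (T g)) + (wsum W gs k + wsum T gs k)
      ≡⟨ cong₂ _+_ (at-g (parallel g)) (wsum-parallelogram parallel gs k) ⟩
    (c (X g) + c (Z g)) + (wsum X gs k + wsum Z gs k)
      ≡⟨ interchange (c (X g)) (c (Z g)) (wsum X gs k) (wsum Z gs k) ⟩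
    (c (X g) + wsum X gs k) + (c (Z g) + wsum Z gs k)  ∎
    where
    open ≡-Reasoning
    c : Bool → ℤ
    c b = sgn b * vec g k
    at-g : (W g ≡ X g × T g ≡ Z g) ⊎ (W g ≡ Z g × T g ≡ X g) → c (W g) + c (T g) ≡ c (X g) + c (Z g)
    at-g (inj₁ (W≡X , T≡Z)) = cong₂ (λ w t → c w + c t) W≡X T≡Z
    at-g (inj₂ (W≡Z , T≡X)) =
      trans (cong₂ (λ w t → c w + c t) W≡Z T≡X) (ℤP.+-comm (c (Z g)) (c (X g)))

  HasScore-parallelogram : ∀ {T X Z W : Tournament Φ n} {s} → Parallelogram T X Z W →
                           HasScore T s → HasScore X s → HasScore Z s → HasScore W s
  HasScore-parallelogram {T} {X} {Z} {W} {s} parallel T-score X-score Z-score k =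
    ∙-cancelʳ (s k) _ _ (begin
      wsum W all k + s k           ≡⟨ cong (λ t → wsum W all k + t) (T-score k) ⟨
      wsum W all k + wsum T all k  ≡⟨ wsum-parallelogram parallel all k ⟩
      wsum X all k + wsum Z all k  ≡⟨ cong₂ _+_ (X-score k) (Z-score k) ⟩
      s k + s k                    ∎)
    where
    open ≡-Reasoning
    all : List (Game n Φ)
    all = allGames Φ n

Disjoint-sym : ∀ {n Φ} {G H : Gen n Φ} → Disjoint G H → Disjoint H G
Disjoint-sym G∩H=∅ g g∈H g∈G = G∩H=∅ g g∈G g∈H

mult-clover : ∀ {n Φ} (G : Gen n Φ) → IsClover G → mult G ≡ 2
mult-clover (clover _ _ _ _ _) _ = refl

mult-non-clover : ∀ {n Φ} (G : Gen n Φ) → ¬ IsClover G → mult G ≡ 1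
mult-non-clover (triangle _ _ _ _ _ _ _ _ _) _          = refl
mult-non-clover (pair _ _ _ _)               _          = refl
mult-non-clover (clover _ _ _ _ _)           non-clover = contradiction tt non-clover

DiamondShape-swap : ∀ {Φ n} {s2 : Fin n → ℤ} {T₁ T₂ : Tournament Φ n} {a b c d} →
                    DiamondShape s2 T₁ T₂ a b c d → DiamondShape s2 T₁ T₂ c d a b
DiamondShape-swap (T₁≢T₂ , not-adjacent , X , Y , X≢Y , T₁X , XT₂ , T₁Y , YT₂ , only-X-Y) =
  T₁≢T₂ , not-adjacent , Y , X , (λ Y≐X → X≢Y (sym ∘ Y≐X)) , T₁Y , YT₂ , T₁X , XT₂ ,
  λ Z T₁Z ZT₂ → Sum.swap (only-X-Y Z T₁Z ZT₂)

module DisjointFlips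
  {n : ℕ} {Φ : Typ} (s2 : Fin n → ℤ) {T₁ T₁₂ T₂ : Tournament Φ n} {G₁ G₂ : Gen n Φ}
  (T₁₂-score : HasScore T₁₂ s2) (T₁-score : HasScore T₁ s2) (T₂-score : HasScore T₂ s2)
  (G₁-neutral : Neutral T₁₂ G₁) (G₂-neutral : Neutral T₁₂ G₂)
  (T₁₂→T₁ : Flip T₁₂ G₁ T₁) (T₁₂→T₂ : Flip T₁₂ G₂ T₂) (G₁∩G₂=∅ : Disjoint G₁ G₂) where

  Y : Tournament Φ n
  Y = T₁ ⊛ G₂

  T₁→T₁₂ : Flip T₁ G₁ T₁₂
  T₁→T₁₂ = Flip-sym T₁₂→T₁

  T₁→Y : Flip T₁ G₂ Y
  T₁→Y = Flip-⊛

  Y→T₂ : Flip Y G₁ T₂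
  Y→T₂ = Flip-sym (Flip-square T₁₂→T₁ T₁₂→T₂ T₁→Y)

  Y-score : HasScore Y s2
  Y-score = HasScore-parallelogram (Flip-parallelogram T₁₂→T₁ T₁₂→T₂ T₁→Y G₁∩G₂=∅)
    T₁₂-score T₁-score T₂-score

  G₁-neutral-T₁ : Neutral T₁ G₁
  G₁-neutral-T₁ = Neutral-Flip G₁-neutral T₁₂→T₁

  G₂-neutral-T₁ : Neutral T₁ G₂
  G₂-neutral-T₁ = Neutral-Flip-disjoint G₂-neutral T₁₂→T₁ (Disjoint-sym G₁∩G₂=∅)

  G₁-neutral-Y : Neutral Y G₁
  G₁-neutral-Y = Neutral-Flip-disjoint G₁-neutral-T₁ T₁→Y G₁∩G₂=∅

  games₁₂ : Vector (Game n Φ) 6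
  games₁₂ = game G₁ ++ game G₂

  games₁₂-injective : Injective _≡_ _≡_ games₁₂
  games₁₂-injective = ++-injective (game-injective G₁) (game-injective G₂)
    (λ i j eq → G₁∩G₂=∅ _ (∈-games⁺ G₁ i) (subst (_∈ games G₂) (sym eq) (∈-games⁺ G₂ j)))

  T₁≢T₂-on-games₁₂ : ∀ k → T₂ (games₁₂ k) ≢ T₁ (games₁₂ k)
  T₁≢T₂-on-games₁₂ k = Flip²-once⇒≢ T₁→T₁₂ T₁₂→T₂ (Sum.map
    (λ g∈G₁ → g∈G₁ , G₁∩G₂=∅ _ g∈G₁)
    (λ g∈G₂ → (λ g∈G₁ → G₁∩G₂=∅ _ g∈G₁ g∈G₂) , g∈G₂)
    (game-++-∈ {G = G₁} {H = G₂} k))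

  T₁≢T₂ : ¬ (T₁ ≐ T₂)
  T₁≢T₂ T₁≐T₂ = T₁≢T₂-on-games₁₂ 0F (sym (T₁≐T₂ (games₁₂ 0F)))

  T₁₂≢Y : ¬ (T₁₂ ≐ Y)
  T₁₂≢Y T₁₂≐Y =
    Flip²-once⇒≢ T₁₂→T₁ T₁→Y (inj₂ ((λ g∈G₁ → G₁∩G₂=∅ g g∈G₁ g∈G₂) , g∈G₂)) (sym (T₁₂≐Y g))
    where
    g = game G₂ 0F
    g∈G₂ = ∈-games⁺ G₂ 0F

  not-adjacent : ¬ Adjacent s2 T₁ T₂
  not-adjacent (_ , _ , _ , _ , _ , T₁→T₂ , _) = contradiction
    (injective-cover⇒≤ games₁₂-injective (∈-games⁻ ∘ Flip-≢⇒∈ T₁→T₂ ∘ T₁≢T₂-on-games₁₂))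
    λ { (s≤s (s≤s (s≤s ()))) }

  common-neighbours : ∀ Z → Adjacent s2 T₁ Z → Adjacent s2 Z T₂ → (Z ≐ T₁₂) ⊎ (Z ≐ Y)
  common-neighbours Z (_ , _ , _ , H₁ , H₁-neutral , T₁→Z , _) (_ , _ , _ , H₂ , _ , Z→T₂ , _) =
    Sum.map (same-flip T₁→T₁₂) (same-flip T₁→Y)
      (all-on-one-side {P = In G₁} {Q = In G₂} side (λ {p} → G₁∩G₂=∅ (game H₁ p))
        (neutral-third-closed {T = T₁} {G = G₁} {H = H₁} G₁-neutral-T₁ H₁-neutral)
        (neutral-third-closed {T = T₁} {G = G₂} {H = H₁} G₂-neutral-T₁ H₁-neutral))
    where
    In : Gen n Φ → Fin 3 → Set
    In G p = game H₁ p ∈ games G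
    cover : ∀ k → ∃ λ s → games₁₂ k ≡ (game H₁ ++ game H₂) s
    cover = ∈⇒game-++ ∘ Flip²-≢⇒∈ T₁→Z Z→T₂ ∘ T₁≢T₂-on-games₁₂
    side : ∀ p → In G₁ p ⊎ In G₂ p
    side p =
      side-of (injective-cover⇒onto {W = game H₁ ++ game H₂} games₁₂-injective cover (p ↑ˡ 3))
      where
      side-of : (∃ λ k → games₁₂ k ≡ (game H₁ ++ game H₂) (p ↑ˡ 3)) → In G₁ p ⊎ In G₂ p
      side-of (k , eq) = subst (λ g → g ∈ games G₁ ⊎ g ∈ games G₂)
        (trans eq (lookup-++ˡ (game H₁) (game H₂) p)) (game-++-∈ {G = G₁} {H = G₂} k)
    same-flip : ∀ {G X} → Flip T₁ G X → (∀ p → In G p) → Z ≐ X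
    same-flip {G} T₁→X H₁-in-G = Flip-unique T₁→Z T₁→X H₁⊆G (games⊆⇒⊇ {G = H₁} {H = G} H₁⊆G)
      where
      H₁⊆G : games H₁ ⊆ games G
      H₁⊆G g∈H₁ with p , refl ← ∈-games⁻ {G = H₁} g∈H₁ = H₁-in-G p

  diamond : DiamondShape s2 T₁ T₂ (mult G₁) (mult G₂) (mult G₂) (mult G₁)
  diamond = T₁≢T₂ , not-adjacent , T₁₂ , Y , T₁₂≢Y ,
    (T₁-score  , T₁₂-score , G₁ , G₁-neutral-T₁ , T₁→T₁₂ , refl) ,
    (T₁₂-score , T₂-score  , G₂ , G₂-neutral    , T₁₂→T₂ , refl) ,
    (T₁-score  , Y-score   , G₂ , G₂-neutral-T₁ , T₁→Y   , refl) ,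
    (Y-score   , T₂-score  , G₁ , G₁-neutral-Y  , Y→T₂   , refl) ,
    common-neighbours

lemma15 : (Φ : Typ) (n : ℕ) (s2 : Fin n → ℤ) → InScore Φ n s2 →
            (T₁ T₁₂ T₂ : Tournament Φ n) (G₁ G₂ : Gen n Φ) →
            HasScore T₁₂ s2 → HasScore T₁ s2 → HasScore T₂ s2 →
            IsCopy T₁₂ G₁ → IsCopy T₁₂ G₂ →
            Flip T₁₂ G₁ T₁ → Flip T₁₂ G₂ T₂ →
            Disjoint G₁ G₂ →
            ((¬ IsClover G₁ × ¬ IsClover G₂) → SingleDiamond s2 T₁ T₂) ×
            (((IsClover G₁ × ¬ IsClover G₂) ⊎ (¬ IsClover G₁ × IsClover G₂)) →
               DoubleDiamond s2 T₁ T₂) ×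
            ((IsClover G₁ × IsClover G₂) → QuadrupleDiamond s2 T₁ T₂)
lemma15 Φ n s2 _ T₁ T₁₂ T₂ G₁ G₂
        T₁₂-score T₁-score T₂-score G₁-neutral G₂-neutral T₁₂→T₁ T₁₂→T₂ G₁∩G₂=∅ =
  (λ { (c₁ , c₂) → shape (mult-non-clover G₁ c₁) (mult-non-clover G₂ c₂) }) ,
  [ (λ { (c₁ , c₂) → shape (mult-clover G₁ c₁) (mult-non-clover G₂ c₂) })
  , (λ { (c₁ , c₂) → DiamondShape-swap (shape (mult-non-clover G₁ c₁) (mult-clover G₂ c₂)) })
  ]′ ,
  (λ { (c₁ , c₂) → shape (mult-clover G₁ c₁) (mult-clover G₂ c₂) })
  where
  shape : ∀ {a b} → mult G₁ ≡ a → mult G₂ ≡ b → DiamondShape s2 T₁ T₂ a b b a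
  shape refl refl = DisjointFlips.diamond s2 T₁₂-score T₁-score T₂-score
    G₁-neutral G₂-neutral T₁₂→T₁ T₁₂→T₂ G₁∩G₂=∅
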